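{- For all conditional propositions $X,Y$: $\vdash\lfloor[X][X]Y\leftrightarrow[X]Y\rfloor$.
   Context: $\mathcal{C}$: smallest set containing $\bot$ and a set of atoms, closed under $X\to Y$ and $[X]Y$; $\neg X:=X\to\bot$, $X\vee Y:=\neg X\to Y$, $X\wedge Y:=\neg(\neg X\vee\neg Y)$, $\top:=\neg\bot$, $X\leftrightarrow Y:=(X\to Y)\wedge(Y\to X)$. Bayesian propositions $\lfloor X_1|\cdots|X_n\rfloor$ ($n\ge1$); $\Gamma,\Delta$ finite possibly empty sequences. Proof system: axioms $\lfloor A\rfloor$ for instances over $\mathcal{C}$ of a standard Hilbert system for classical propositional logic; $\lfloor[X](Y\to Z)\to([X]Y\to[X]Z)\rfloor$; $\lfloor[X]Y\to(X\to Y)\rfloor$; $\lfloor[X]\neg Y\leftrightarrow\neg[X]Y\rfloor$. Rules: from $\lfloor\Gamma|X\rfloor$, $\lfloor\Delta|X\to Y\rfloor$ infer $\lfloor\Gamma|\Delta|Y\rfloor$; permutation of components; from $\lfloor\Gamma|X|X\rfloor$ infer $\lfloor\Gamma|X\rfloor$; from $\lfloor\Gamma\rfloor$ infer $\lfloor\Gamma|X\rfloor$; from $\lfloor\Gamma|X\to Y\rfloor$ infer $\lfloor\Gamma|\neg X|[X]Y\rfloor$; from $\lfloor\Gamma|Y\leftrightarrow\neg X\rfloor$, $\lfloor\Gamma|[X]Z\leftrightarrow Z\rfloor$ infer $\lfloor\Gamma|[Y]Z\leftrightarrow Z\rfloor$. $\vdash$ means derivable. -}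

module Defs where

open import Data.List using (List; []; _∷_; _++_; [_])
open import Data.List.Relation.Binary.Permutation.Propositional using (_↭_)

data Cond (Atom : Set) : Set where
  ⊥c   : Cond Atom
  atom : Atom → Cond Atom
  _⇒_  : Cond Atom → Cond Atom → Cond Atom
  ⟦_⟧_ : Cond Atom → Cond Atom → Cond Atom

infixr 5 _⇒_
infix 6 ⟦_⟧_

module _ {Atom : Set} where
  ¬c_ : Cond Atom → Cond Atom
  ¬c X = X ⇒ ⊥c

  _∨c_ : Cond Atom → Cond Atom → Cond Atom
  X ∨c Y = (¬c X) ⇒ Y

  _∧c_ : Cond Atom → Cond Atom → Cond Atom
  X ∧c Y = ¬c ((¬c X) ∨c (¬c Y))

  ⊤c : Cond Atom
  ⊤c = ¬c ⊥c

  _⇔_ : Cond Atom → Cond Atom → Cond Atom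
  X ⇔ Y = (X ⇒ Y) ∧c (Y ⇒ X)

  -- Bayesian propositions ⌊X₁|⋯|Xₙ⌋ are represented by the list X₁ ∷ ⋯ ∷ Xₙ ∷ [].
  -- (Only nonempty lists are ever derivable; weakening requires a derivable premise.)
  -- Standard Hilbert system for classical propositional logic over ⊥, →
  -- (Łukasiewicz/Mendelson axioms with ¬X := X → ⊥), plus the modal axioms.
  data ⊢_ : List (Cond Atom) → Set where
    ax1 : ∀ X Y → ⊢ [ X ⇒ (Y ⇒ X) ]
    ax2 : ∀ X Y Z → ⊢ [ (X ⇒ (Y ⇒ Z)) ⇒ ((X ⇒ Y) ⇒ (X ⇒ Z)) ]
    ax3 : ∀ X Y → ⊢ [ ((¬c Y) ⇒ (¬c X)) ⇒ (((¬c Y) ⇒ X) ⇒ Y) ]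
    axK : ∀ X Y Z → ⊢ [ (⟦ X ⟧ (Y ⇒ Z)) ⇒ ((⟦ X ⟧ Y) ⇒ (⟦ X ⟧ Z)) ]
    axT : ∀ X Y → ⊢ [ (⟦ X ⟧ Y) ⇒ (X ⇒ Y) ]
    axN : ∀ X Y → ⊢ [ (⟦ X ⟧ (¬c Y)) ⇔ (¬c (⟦ X ⟧ Y)) ]
    mp  : ∀ {Γ Δ X Y} → ⊢ (Γ ++ [ X ]) → ⊢ (Δ ++ [ X ⇒ Y ]) → ⊢ (Γ ++ Δ ++ [ Y ])
    perm : ∀ {Γ Δ} → Γ ↭ Δ → ⊢ Γ → ⊢ Δ
    contr : ∀ {Γ X} → ⊢ (Γ ++ X ∷ X ∷ []) → ⊢ (Γ ++ [ X ])
    weak : ∀ {G Γ X} → ⊢ (G ∷ Γ) → ⊢ (G ∷ Γ ++ [ X ])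
    cond : ∀ {Γ X Y} → ⊢ (Γ ++ [ X ⇒ Y ]) → ⊢ (Γ ++ (¬c X) ∷ (⟦ X ⟧ Y) ∷ [])
    subst : ∀ {Γ X Y Z} → ⊢ (Γ ++ [ Y ⇔ (¬c X) ]) → ⊢ (Γ ++ [ (⟦ X ⟧ Z) ⇔ Z ])
          → ⊢ (Γ ++ [ (⟦ Y ⟧ Z) ⇔ Z ])

module Submission where

-- Idea.  Write Z = [X]Y and T = ([X]Z ⇔ Z).  The proof has two halves.
--
-- (1) Under its antecedent a conditional agrees with its consequent:
--     ⊢ ⌊X → ([X]Y ↔ Y)⌋, from axiom T for Y and for ¬Y together with the
--     negation axiom.  Feeding the two directions of (1) to the conditioning
--     rule and distributing with axiom K gives ⌊¬X | T⌋.
-- (2) In a component where ¬X holds, [X]Z is equivalent to Z: (1) applied to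
--     the antecedent ¬X gives [¬X]Z ↔ Z there, and the substitution rule
--     transports this along X ↔ ¬¬X.  Applied to ⌊T | ¬X⌋ this yields ⌊T | T⌋,
--     and contraction gives ⌊T⌋.

open import Defs
open import Data.List using (List; []; _∷_; [_])
open import Data.List.Membership.Propositional using (_∈_)
open import Data.List.Relation.Unary.Any using (here; there)
open import Data.List.Relation.Binary.Permutation.Propositional using (_↭_; refl; prep; swap; trans)
open import Relation.Binary.PropositionalEquality using (refl)

module _ {Atom : Set} where

  private
    F : Set
    F = Cond Atom

  mp₁ : ∀ {A B : F} → ⊢ [ A ⇒ B ] → ⊢ [ A ] → ⊢ [ B ]
  mp₁ f a = mp {Γ = []} {Δ = []} a f

  identity : (A : F) → ⊢ [ A ⇒ A ]
  identity A = mp₁ (mp₁ (ax2 A (A ⇒ A) A) (ax1 A (A ⇒ A))) (ax1 A A)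

  data _⊩_ (H : List F) : F → Set where
    hyp : ∀ {A} → A ∈ H → H ⊩ A
    thm : ∀ {A} → ⊢ [ A ] → H ⊩ A
    app : ∀ {A B} → H ⊩ (A ⇒ B) → H ⊩ A → H ⊩ B

  infix 4 _⊩_

  deduction : ∀ {H A B} → A ∷ H ⊩ B → H ⊩ A ⇒ B
  deduction {A = A} (hyp (here refl)) = thm (identity A)
  deduction {A = A} (hyp (there p))   = app (thm (ax1 _ A)) (hyp p)
  deduction {A = A} (thm t)           = app (thm (ax1 _ A)) (thm t)
  deduction {A = A} (app f a)         = app (app (thm (ax2 A _ _)) (deduction f)) (deduction a)

  close : ∀ {A} → [] ⊩ A → ⊢ [ A ]
  close (hyp ())
  close (thm t)   = t
  close (app f a) = mp₁ (close f) (close a)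

  weaken : ∀ {H A B} → H ⊩ A → B ∷ H ⊩ A
  weaken (hyp p)   = hyp (there p)
  weaken (thm t)   = thm t
  weaken (app f a) = app (weaken f) (weaken a)

  hyp₀ : ∀ {H A} → A ∷ H ⊩ A
  hyp₀ = hyp (here refl)

  hyp₁ : ∀ {H A B} → B ∷ A ∷ H ⊩ A
  hyp₁ = hyp (there (here refl))

  hyp₂ : ∀ {H A B C} → C ∷ B ∷ A ∷ H ⊩ A
  hyp₂ = hyp (there (there (here refl)))

  doubleNegation : ∀ {A : F} → ⊢ [ ¬c (¬c A) ⇒ A ]
  doubleNegation {A} =
    close (deduction (app (app (thm (ax3 (¬c A) A)) (deduction hyp₁)) (deduction hyp₀)))

  byContradiction : ∀ {H A} → ¬c A ∷ H ⊩ ⊥c → H ⊩ A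
  byContradiction p = app (thm doubleNegation) (deduction p)

  ∧-intro : ∀ {H A B} → H ⊩ A → H ⊩ B → H ⊩ A ∧c B
  ∧-intro a b = deduction (app (app hyp₀ (deduction (app hyp₀ (weaken (weaken a))))) (weaken b))

  ∧-elimʳ : ∀ {H A B} → H ⊩ A ∧c B → H ⊩ B
  ∧-elimʳ p = byContradiction (app (weaken p) (deduction hyp₁))

  ⇔-intro : ∀ {A B : F} → ⊢ [ (A ⇒ B) ⇒ ((B ⇒ A) ⇒ (A ⇔ B)) ]
  ⇔-intro = close (deduction (deduction (∧-intro hyp₁ hyp₀)))

  ⇔-doubleNegation : (X : F) → ⊢ [ X ⇔ (¬c (¬c X)) ]
  ⇔-doubleNegation X = close (∧-intro (deduction (deduction (app hyp₀ hyp₁))) (thm doubleNegation))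

  -- Under its antecedent a conditional implies its consequent (axiom T) ...
  conditional-elim : (X Y : F) → ⊢ [ X ⇒ ((⟦ X ⟧ Y) ⇒ Y) ]
  conditional-elim X Y = close (deduction (deduction (app (app (thm (axT X Y)) hyp₀) hyp₁)))

  -- ... and is implied by it: otherwise [X]¬Y, i.e. ¬[X]Y by the negation
  -- axiom, would give ¬Y under X.
  conditional-intro : (X Y : F) → ⊢ [ X ⇒ (Y ⇒ (⟦ X ⟧ Y)) ]
  conditional-intro X Y = close (deduction (deduction (byContradiction
    (app (app (app (thm (axT X (¬c Y))) (app (∧-elimʳ (thm (axN X Y))) hyp₀)) hyp₂) hyp₁))))

  conditional-agrees : (X Y : F) → ⊢ [ X ⇒ ((⟦ X ⟧ Y) ⇔ Y) ]
  conditional-agrees X Y = close (deduction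
    (∧-intro (app (thm (conditional-elim X Y)) hyp₀) (app (thm (conditional-intro X Y)) hyp₀)))

  exchange : ∀ {A B : F} → ⊢ (A ∷ [ B ]) → ⊢ (B ∷ [ A ])
  exchange = perm (swap _ _ refl)

  lastMap : ∀ {G A B : F} → ⊢ [ A ⇒ B ] → ⊢ (G ∷ [ A ]) → ⊢ (G ∷ [ B ])
  lastMap {G} f p = mp {Γ = [ G ]} {Δ = []} p f

  lastMap₂ : ∀ {G A B C : F} → ⊢ [ A ⇒ (B ⇒ C) ] → ⊢ (G ∷ [ A ]) → ⊢ (G ∷ [ B ])
           → ⊢ (G ∷ [ C ])
  lastMap₂ {G} {C = C} f p q = exchange (contr {Γ = [ C ]} (perm moveLast GGC))
    where
    GGC : ⊢ (G ∷ G ∷ [ C ])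
    GGC = mp {Γ = [ G ]} {Δ = [ G ]} q (lastMap f p)
    moveLast : (G ∷ G ∷ [ C ]) ↭ (C ∷ G ∷ [ G ])
    moveLast = trans (prep G (swap G C refl)) (swap G C refl)

  conditional-mono : ∀ {X A B : F} → ⊢ [ X ⇒ (A ⇒ B) ] → ⊢ ((¬c X) ∷ [ (⟦ X ⟧ A) ⇒ (⟦ X ⟧ B) ])
  conditional-mono {X} {A} {B} p = lastMap (axK X A B) (cond {Γ = []} p)

  negatedAntecedent : ∀ {G X : F} (Z : F) → ⊢ (G ∷ [ ¬c X ]) → ⊢ (G ∷ [ (⟦ X ⟧ Z) ⇔ Z ])
  negatedAntecedent {G} {X} Z p =
    subst {Γ = [ G ]} {X = ¬c X} {Y = X} equivalentAntecedent agreesUnderNegation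
    where
    agreesUnderNegation : ⊢ (G ∷ [ (⟦ ¬c X ⟧ Z) ⇔ Z ])
    agreesUnderNegation = lastMap (conditional-agrees (¬c X) Z) p
    equivalentAntecedent : ⊢ (G ∷ [ X ⇔ (¬c (¬c X)) ])
    equivalentAntecedent = exchange (weak {Γ = []} (⇔-doubleNegation X))

mainTheorem18 : {Atom : Set} (X Y : Cond Atom) → ⊢ [ (⟦ X ⟧ (⟦ X ⟧ Y)) ⇔ (⟦ X ⟧ Y) ]
mainTheorem18 {Atom} X Y = contr {Γ = []} (negatedAntecedent Z (exchange idempotentUnderNegation))
  where
  Z : Cond Atom
  Z = ⟦ X ⟧ Y
  idempotentUnderNegation : ⊢ ((¬c X) ∷ [ (⟦ X ⟧ Z) ⇔ Z ])
  idempotentUnderNegation = lastMap₂ ⇔-intro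
    (conditional-mono (conditional-elim X Y))
    (conditional-mono (conditional-intro X Y))
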